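{- If $T$ is a tree with $n\ge 3$ vertices, then there exists a TD-coloring of $T$ using $\chi_{td}(T)$ colors such that, for every support vertex $v$ of $T$, all leaves adjacent to $v$ receive the same color.
   Context: A total dominator coloring (TD-coloring) of a graph without isolated vertices is a proper vertex coloring in which every vertex is adjacent to all vertices of some color class; $\chi_{td}$ denotes the minimum number of colors in a TD-coloring. A leaf is a vertex of degree 1; a support vertex is a vertex adjacent to a leaf. -}

module Defs where

open import Data.Nat using (ℕ; _≤_; _<_)
open import Data.Fin using (Fin)
open import Data.Bool using (Bool; true; false)
open import Data.List using (List; []; _∷_; length)
open import Data.List.Relation.Unary.Unique.Propositional using (Unique)
open import Data.Product using (Σ; ∃; ∃-syntax; _×_; _,_)
open import Relation.Binary.PropositionalEquality using (_≡_; _≢_)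
open import Relation.Nullary using (¬_)

record Graph (n : ℕ) : Set where
  field
    adj   : Fin n → Fin n → Bool
    sym   : ∀ u v → adj u v ≡ adj v u
    irrefl : ∀ v → adj v v ≡ false

open Graph public

Adj : ∀ {n} → Graph n → Fin n → Fin n → Set
Adj G u v = adj G u v ≡ true

data Walk {n} (G : Graph n) : Fin n → Fin n → List (Fin n) → Set where
  here : ∀ v → Walk G v v (v ∷ [])
  step : ∀ {u v w vs} → Adj G u v → Walk G v w vs → Walk G u w (u ∷ vs)

Connected : ∀ {n} → Graph n → Set
Connected {n} G = ∀ (u v : Fin n) → ∃[ vs ] Walk G u v vs

HasCycle : ∀ {n} → Graph n → Set
HasCycle {n} G =
  ∃[ u ] ∃[ v ] ∃[ vs ] (Walk G u v vs × Unique vs × 3 ≤ length vs × Adj G v u)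

IsTree : ∀ {n} → Graph n → Set
IsTree G = Connected G × ¬ HasCycle G

NoIsolated : ∀ {n} → Graph n → Set
NoIsolated {n} G = ∀ (v : Fin n) → ∃[ u ] Adj G v u

IsLeaf : ∀ {n} → Graph n → Fin n → Set
IsLeaf {n} G v = ∃[ u ] (Adj G v u × (∀ (w : Fin n) → Adj G v w → w ≡ u))

IsSupport : ∀ {n} → Graph n → Fin n → Set
IsSupport {n} G v = ∃[ u ] (Adj G v u × IsLeaf G u)

UsesAllColors : ∀ {n k} → (Fin n → Fin k) → Set
UsesAllColors {n} {k} c = ∀ (i : Fin k) → ∃[ v ] c v ≡ i

Proper : ∀ {n k} → Graph n → (Fin n → Fin k) → Set
Proper G c = ∀ u v → Adj G u v → c u ≢ c v

TotallyDominating : ∀ {n k} → Graph n → (Fin n → Fin k) → Set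
TotallyDominating {n} {k} G c =
  ∀ (v : Fin n) → ∃[ i ] ((∃[ w ] c w ≡ i) × (∀ (w : Fin n) → c w ≡ i → Adj G v w))

IsTDColoring : ∀ {n k} → Graph n → (Fin n → Fin k) → Set
IsTDColoring G c = UsesAllColors c × Proper G c × TotallyDominating G c

HasTDColoring : ∀ {n} → Graph n → ℕ → Set
HasTDColoring {n} G k = Σ (Fin n → Fin k) λ c → IsTDColoring G c

IsChiTD : ∀ {n} → Graph n → ℕ → Set
IsChiTD G k = HasTDColoring G k × (∀ m → m < k → ¬ HasTDColoring G m)

-- Given a minimum TD-colouring c, recolour every leaf x with the colour of one
-- representative leaf of its support vertex v, choosing the representative
-- among the leaves of v whose colour is the class dominated by v, if any.
-- Leaves are adjacent only to their support vertex, so the new colouring stays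
-- proper, and a class dominated by u can only gain leaves of u, so every vertex
-- still dominates its class. By minimality of χ_td the new colouring again uses
-- all colours, since an unused colour could be dropped.
module Submission where

open import Defs hiding (sym)
open import Data.Nat using (ℕ; _≤_; _<_; zero; suc; s≤s)
open import Data.Nat.Properties using (≤-refl; <⇒≤)
open import Data.Fin using (Fin; punchOut)
open import Data.Fin.Properties using (any?; all?; ¬∀⟶∃¬; punchOut-injective) renaming (_≟_ to _≟F_)
open import Data.Bool using (true)
open import Data.Bool.Properties using () renaming (_≟_ to _≟B_)
open import Data.Product using (Σ; ∃-syntax; _×_; _,_; proj₁; proj₂)
open import Data.Empty using (⊥; ⊥-elim)
open import Relation.Nullary using (Dec; yes; no; ¬_)
open import Relation.Nullary.Decidable.Core using (_×-dec_; _→-dec_)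
open import Relation.Binary.PropositionalEquality using (_≡_; _≢_; refl; sym; trans; cong; subst; subst₂)

module _ {n : ℕ} (G : Graph n) where

  Adj-sym : ∀ {u v} → Adj G u v → Adj G v u
  Adj-sym {u} {v} a = trans (sym (Graph.sym G u v)) a

  Adj? : ∀ u v → Dec (Adj G u v)
  Adj? u v = adj G u v ≟B true

  leaf-neighbour-unique : ∀ {x w w′} → IsLeaf G x → Adj G x w → Adj G x w′ → w ≡ w′
  leaf-neighbour-unique (_ , _ , only) aw aw′ = trans (only _ aw) (sym (only _ aw′))

  IsLeaf? : ∀ x → Dec (IsLeaf G x)
  IsLeaf? x with any? (Adj? x)
  ... | no ¬nbr = no λ { (u , a , _) → ¬nbr (u , a) }
  ... | yes (u , a) with all? (λ w → Adj? x w →-dec (w ≟F u))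
  ...   | yes only = yes (u , a , only)
  ...   | no ¬only = no λ { (_ , _ , only) → ¬only λ w aw → trans (only w aw) (sym (only u a)) }

  ProperTD : ∀ {k} → (Fin n → Fin k) → Set
  ProperTD c = Proper G c × TotallyDominating G c

  UsesAllColors? : ∀ {k} (c : Fin n → Fin k) → Dec (UsesAllColors c)
  UsesAllColors? c = all? λ i → any? λ v → c v ≟F i

  dropUnusedColour : ∀ {m} (c : Fin n → Fin (suc m)) (j : Fin (suc m)) →
    (∀ x → j ≢ c x) → ProperTD c → Σ (Fin n → Fin m) ProperTD
  dropUnusedColour c j unused (proper , td) = c′ , proper′ , td′
    where
    c′ : Fin n → Fin _
    c′ x = punchOut (unused x)

    c′-injective : ∀ {x y} → c′ x ≡ c′ y → c x ≡ c y
    c′-injective {x} {y} = punchOut-injective (unused x) (unused y)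

    proper′ : Proper G c′
    proper′ u v a eq = proper u v a (c′-injective eq)

    td′ : TotallyDominating G c′
    td′ v with td v
    ... | _ , (w , cw) , dominated = c′ w , (w , refl) , λ x eq → dominated x (trans (c′-injective eq) cw)

  ProperTD⇒HasTDColoring≤ : ∀ {m} (c : Fin n → Fin m) → ProperTD c →
    ∃[ m′ ] (m′ ≤ m × HasTDColoring G m′)
  ¬UsesAllColors⇒HasTDColoring< : ∀ {m} (c : Fin n → Fin m) → ProperTD c →
    ¬ UsesAllColors c → ∃[ m′ ] (m′ < m × HasTDColoring G m′)

  ProperTD⇒HasTDColoring≤ {m} c ptd with UsesAllColors? c
  ... | yes all = m , ≤-refl , c , all , ptd
  ... | no ¬all with ¬UsesAllColors⇒HasTDColoring< c ptd ¬all
  ...   | m′ , m′<m , has = m′ , <⇒≤ m′<m , has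

  ¬UsesAllColors⇒HasTDColoring< {zero} c ptd ¬all = ⊥-elim (¬all λ ())
  ¬UsesAllColors⇒HasTDColoring< {suc m} c ptd ¬all
    with ¬∀⟶∃¬ _ _ (λ i → any? λ v → c v ≟F i) ¬all
  ... | j , ¬used with dropUnusedColour c j (λ x eq → ¬used (x , sym eq)) ptd
  ...   | c′ , ptd′ with ProperTD⇒HasTDColoring≤ c′ ptd′
  ...     | m′ , m′≤m , has = m′ , s≤s m′≤m , has

  ProperTD-usesAllColors : ∀ {k} → (∀ m → m < k → ¬ HasTDColoring G m) →
    (c : Fin n → Fin k) → ProperTD c → UsesAllColors c
  ProperTD-usesAllColors fewer c ptd with UsesAllColors? c
  ... | yes all = all
  ... | no ¬all with ¬UsesAllColors⇒HasTDColoring< c ptd ¬all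
  ...   | m , m<k , has = ⊥-elim (fewer m m<k has)

  LeafOf : Fin n → Fin n → Set
  LeafOf v y = Adj G v y × IsLeaf G y

  LeafOf? : ∀ v y → Dec (LeafOf v y)
  LeafOf? v y = Adj? v y ×-dec IsLeaf? y

  LeafOf-neighbour : ∀ {u v y} → LeafOf v y → Adj G u y → u ≡ v
  LeafOf-neighbour (avy , ly) auy = leaf-neighbour-unique ly (Adj-sym auy) (Adj-sym avy)

  module LeafUniform {k} (c : Fin n → Fin k) (proper : Proper G c) (td : TotallyDominating G c) where

    dominated : Fin n → Fin k
    dominated v = proj₁ (td v)

    dominatedLeaf? : ∀ v → Dec (∃[ y ] (LeafOf v y × c y ≡ dominated v))
    dominatedLeaf? v = any? λ y → LeafOf? v y ×-dec (c y ≟F dominated v)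

    -- The second argument is a default, returned only when v supports no leaf.
    chosenLeaf : Fin n → Fin n → Fin n
    chosenLeaf v d with dominatedLeaf? v
    ... | yes (y , _) = y
    ... | no _ with any? (LeafOf? v)
    ...   | yes (y , _) = y
    ...   | no _ = d

    chosenLeaf-LeafOf : ∀ v d {y} → LeafOf v y → LeafOf v (chosenLeaf v d)
    chosenLeaf-LeafOf v d {y} ly with dominatedLeaf? v
    ... | yes (_ , ly′ , _) = ly′
    ... | no _ with any? (LeafOf? v)
    ...   | yes (_ , l) = l
    ...   | no ¬leaf = ⊥-elim (¬leaf (y , ly))

    chosenLeaf-dominated : ∀ v d {y} → LeafOf v y → c y ≡ dominated v →
      c (chosenLeaf v d) ≡ dominated v
    chosenLeaf-dominated v d {y} ly cy with dominatedLeaf? v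
    ... | yes (_ , _ , cy′) = cy′
    ... | no ¬found = ⊥-elim (¬found (y , ly , cy))

    chosenLeaf-default-irrelevant : ∀ v d d′ {y} → LeafOf v y → chosenLeaf v d ≡ chosenLeaf v d′
    chosenLeaf-default-irrelevant v d d′ {y} ly with dominatedLeaf? v
    ... | yes _ = refl
    ... | no _ with any? (LeafOf? v)
    ...   | yes _ = refl
    ...   | no ¬leaf = ⊥-elim (¬leaf (y , ly))

    representative : Fin n → Fin n
    representative x with IsLeaf? x
    ... | yes (v , _) = chosenLeaf v x
    ... | no _ = x

    representative-nonLeaf : ∀ {x} → ¬ IsLeaf G x → representative x ≡ x
    representative-nonLeaf {x} ¬lx with IsLeaf? x
    ... | yes lx = ⊥-elim (¬lx lx)
    ... | no _ = refl

    representative-leaf : ∀ {x v} → IsLeaf G x → Adj G x v → representative x ≡ chosenLeaf v x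
    representative-leaf {x} lx axv with IsLeaf? x
    ... | yes (_ , _ , only) = cong (λ u → chosenLeaf u x) (sym (only _ axv))
    ... | no ¬lx = ⊥-elim (¬lx lx)

    representative-LeafOf : ∀ {x v} → IsLeaf G x → Adj G x v → LeafOf v (representative x)
    representative-LeafOf {x} {v} lx axv rewrite representative-leaf lx axv =
      chosenLeaf-LeafOf v x (Adj-sym axv , lx)

    recoloured : Fin n → Fin k
    recoloured x = c (representative x)

    recoloured-nonLeaf : ∀ {x} → ¬ IsLeaf G x → recoloured x ≡ c x
    recoloured-nonLeaf ¬lx = cong c (representative-nonLeaf ¬lx)

    recoloured-proper : Proper G recoloured
    recoloured-proper u v a eq = byLeafCases (IsLeaf? u) (IsLeaf? v)
      where
      byLeafCases : Dec (IsLeaf G u) → Dec (IsLeaf G v) → ⊥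
      byLeafCases (no ¬lu) (no ¬lv) =
        proper u v a (subst₂ (λ s t → c s ≡ c t) (representative-nonLeaf ¬lu) (representative-nonLeaf ¬lv) eq)
      byLeafCases (yes lu) (no ¬lv) =
        proper v _ (proj₁ (representative-LeafOf lu a)) (sym (trans eq (recoloured-nonLeaf ¬lv)))
      byLeafCases (no ¬lu) (yes lv) =
        proper u _ (proj₁ (representative-LeafOf lv (Adj-sym a))) (trans (sym (recoloured-nonLeaf ¬lu)) eq)
      byLeafCases (yes lu) (yes lv) = proper u v a (subst₂ (λ s t → c s ≡ c t) u-only v-only eq)
        where
        -- Two adjacent leaves form a component of their own.
        u-only : representative u ≡ u
        u-only = leaf-neighbour-unique lv (proj₁ (representative-LeafOf lu a)) (Adj-sym a)
        v-only : representative v ≡ v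
        v-only = leaf-neighbour-unique lu (proj₁ (representative-LeafOf lv (Adj-sym a))) a

    recoloured-dominated : ∀ u x → recoloured x ≡ dominated u → Adj G u x
    recoloured-dominated u x eq = byLeafCase (IsLeaf? x)
      where
      dom : ∀ y → c y ≡ dominated u → Adj G u y
      dom = proj₂ (proj₂ (td u))

      byLeafCase : Dec (IsLeaf G x) → Adj G u x
      byLeafCase (no ¬lx) = dom x (trans (sym (recoloured-nonLeaf ¬lx)) eq)
      byLeafCase (yes lx@(v , axv , _)) = subst (λ w → Adj G w x) (sym u≡v) (Adj-sym axv)
        where
        u≡v : u ≡ v
        u≡v = LeafOf-neighbour (representative-LeafOf lx axv) (dom _ eq)

    recoloured-dominated-nonempty : ∀ u → ∃[ y ] recoloured y ≡ dominated u
    recoloured-dominated-nonempty u with proj₁ (proj₂ (td u)) | proj₂ (proj₂ (td u))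
    ... | w , cw | dom = w , byLeafCase (IsLeaf? w)
      where
      byLeafCase : Dec (IsLeaf G w) → recoloured w ≡ dominated u
      byLeafCase (no ¬lw) = trans (recoloured-nonLeaf ¬lw) cw
      byLeafCase (yes lw) = trans (cong c (representative-leaf lw (Adj-sym (dom w cw))))
                                  (chosenLeaf-dominated u w (dom w cw , lw) cw)

    recoloured-TD : TotallyDominating G recoloured
    recoloured-TD u = dominated u , recoloured-dominated-nonempty u , recoloured-dominated u

    recoloured-leafUniform : ∀ v x y → Adj G v x → IsLeaf G x → Adj G v y → IsLeaf G y →
      recoloured x ≡ recoloured y
    recoloured-leafUniform v x y avx lx avy ly = cong c sameRepresentative
      where
      sameRepresentative : representative x ≡ representative y
      sameRepresentative = trans (representative-leaf lx (Adj-sym avx))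
        (trans (chosenLeaf-default-irrelevant v x y (avx , lx))
               (sym (representative-leaf ly (Adj-sym avy))))

proposition2 : ∀ (n : ℕ) (T : Graph n) → 3 ≤ n → IsTree T →
    ∀ (k : ℕ) → IsChiTD T k →
    Σ (Fin n → Fin k) λ c → IsTDColoring T c ×
      (∀ (v x y : Fin n) → IsSupport T v → Adj T v x → IsLeaf T x →
        Adj T v y → IsLeaf T y → c x ≡ c y)
proposition2 n T _ _ k ((c , _ , proper , td) , fewer) =
  recoloured , (usesAll , recoloured-proper , recoloured-TD) ,
  λ v x y _ → recoloured-leafUniform v x y
  where
  open LeafUniform T c proper td
  usesAll : UsesAllColors recoloured
  usesAll = ProperTD-usesAllColors T fewer recoloured (recoloured-proper , recoloured-TD)
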